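{- For every tailed $213$-avoiding permutation $\pi\in\widetilde{\mathfrak{S}}_n(213)$, we have $\mathcal{S}(\pi)=\lambda^{ -1}\circ\Phi\circ\lambda(\pi)$, and $\mathcal{S}(\pi)\in\widetilde{\mathfrak{S}}_n(213)$.
   Context: Stack-sorting: $\mathcal{S}(\emptyset)=\emptyset$, $\mathcal{S}(\alpha\,m\,\beta)=\mathcal{S}(\alpha)\mathcal{S}(\beta)m$ with $m$ the largest letter. For a word $w$ of distinct positive integers, $\lambda(\emptyset)$ is empty and, writing $w=\sigma\,i\,\tau$ with $i$ the smallest letter, $\lambda(w)$ is the increasing binary tree with root $i$, left subtree $\lambda(\sigma)$, right subtree $\lambda(\tau)$; $\lambda$ is a bijection from $\mathfrak{S}_n$ to increasing binary trees on $[n]$, with inverse reading labels in in-order. The tail of $\pi\in\mathfrak{S}_n$ is the longest consecutive increasing factor ending at $\pi_n$. $\pi$ is tailed $213$-avoiding if the subsequence obtained by deleting all elements of its tail except the smallest one avoids $213$; $\widetilde{\mathfrak{S}}_n(213)$ denotes the set of such permutations. For an increasing binary tree $T$, the right arm is the maximal path from the root using right edges only; a right leaf is a node with no right child that is not on the right arm. For a right leaf $v$, $\phi_v(T)$ is obtained by removing $v$ from its position, putting its left subtree (if any) in the position $v$ occupied, and inserting $v$ into the right arm so that the labels along the right arm remain increasing (each former right-arm node keeps its left subtree, and $v$ gets no left child). These operations commute, and $\Phi(T)$ is the result of applying $\phi_v$ for all right leaves $v$ of $T$. -}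

module Defs where

open import Data.Nat using (ℕ; zero; suc; _<_; _⊔_; _⊓_; _<ᵇ_; _≡ᵇ_)
open import Data.Bool using (Bool; true; false; if_then_else_)
open import Data.List using (List; []; _∷_; _++_; length; foldr; foldl; take)
open import Data.Product using (_×_; _,_; ∃-syntax)
open import Data.List.Relation.Binary.Sublist.Propositional using (_⊆_)
open import Relation.Nullary using (¬_)

-- Words are lists of (distinct positive) natural numbers.

maxL : ℕ → List ℕ → ℕ
maxL x xs = foldr _⊔_ x xs

minL : ℕ → List ℕ → ℕ
minL x xs = foldr _⊓_ x xs

splitOn : ℕ → List ℕ → List ℕ × List ℕ
splitOn m [] = [] , []
splitOn m (x ∷ xs) with m ≡ᵇ x
... | true = [] , xs
... | false with splitOn m xs
...   | (a , b) = x ∷ a , b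

-- Stack-sorting S(∅)=∅, S(α m β) = S(α) S(β) m, m the largest letter.
-- Defined with a fuel argument; fuel = length w always suffices.
stackSortF : ℕ → List ℕ → List ℕ
stackSortF zero w = []
stackSortF (suc f) [] = []
stackSortF (suc f) (x ∷ xs) with splitOn (maxL x xs) (x ∷ xs)
... | (a , b) = stackSortF f a ++ stackSortF f b ++ (maxL x xs ∷ [])

stackSort : List ℕ → List ℕ
stackSort w = stackSortF (length w) w

data Tree : Set where
  leaf : Tree
  node : Tree → ℕ → Tree → Tree

lamF : ℕ → List ℕ → Tree
lamF zero w = leaf
lamF (suc f) [] = leaf
lamF (suc f) (x ∷ xs) with splitOn (minL x xs) (x ∷ xs)
... | (a , b) = node (lamF f a) (minL x xs) (lamF f b)

lam : List ℕ → Tree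
lam w = lamF (length w) w

-- λ⁻¹: read labels in in-order
inorder : Tree → List ℕ
inorder leaf = []
inorder (node l x r) = inorder l ++ x ∷ inorder r

noRightChild : Tree → List ℕ
noRightChild leaf = []
noRightChild (node l x leaf) = noRightChild l ++ x ∷ []
noRightChild (node l x r@(node _ _ _)) = noRightChild l ++ noRightChild r

-- right leaves: nodes with no right child that are not on the right arm
rightLeaves : Tree → List ℕ
rightLeaves leaf = []
rightLeaves (node l x r) = noRightChild l ++ rightLeaves r

-- remove node labelled v, putting its left subtree in its place
-- (used only for right leaves v, which have no right child)
removeNode : ℕ → Tree → Tree
removeNode v leaf = leaf
removeNode v (node l x r) with v ≡ᵇ x
... | true = l
... | false = node (removeNode v l) x (removeNode v r)

-- insert v (with no left child) into the right arm, keeping the arm increasing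
insertArm : ℕ → Tree → Tree
insertArm v leaf = node leaf v leaf
insertArm v (node l x r) with v <ᵇ x
... | true = node leaf v (node l x r)
... | false = node l x (insertArm v r)

phi : ℕ → Tree → Tree
phi v t = insertArm v (removeNode v t)

-- Φ(T): apply φ_v for all right leaves v of T (they commute; we use list order)
Phi : Tree → Tree
Phi t = foldl (λ s v → phi v s) t (rightLeaves t)

-- splitTail w = (front , tail), w = front ++ tail, tail the longest increasing
-- factor (consecutive positions) ending at the last letter
splitTail : List ℕ → List ℕ × List ℕ
splitTail [] = [] , []
splitTail (x ∷ xs) with splitTail xs
... | [] , [] = [] , x ∷ []
... | [] , (y ∷ t) = if x <ᵇ y then ([] , x ∷ y ∷ t) else (x ∷ [] , y ∷ t)
... | (z ∷ f) , t = x ∷ z ∷ f , t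

-- delete all tail elements except the smallest (= first) one
reduceTail : List ℕ → List ℕ
reduceTail w with splitTail w
... | (f , t) = f ++ take 1 t

Contains213 : List ℕ → Set
Contains213 w = ∃[ a ] ∃[ b ] ∃[ c ] ((b ∷ a ∷ c ∷ []) ⊆ w × a < b × b < c)

Avoids213 : List ℕ → Set
Avoids213 w = ¬ Contains213 w

Tailed213 : List ℕ → Set
Tailed213 w = Avoids213 (reduceTail w)

-- Write π = σ m τ with m its smallest letter, so that λ(π) has root m and
-- subtrees λ(σ), λ(τ).  Stack sorting is run as the usual stack machine.  If
-- σ m is part of the reduced word of π, then σ avoids 213, and on such a word
-- the stack outputs, in in-order, exactly the nodes of λ(σ) having a right
-- child, while the remaining ones stay on the stack in increasing order.  Φ
-- does the same: those remaining nodes are right leaves of λ(π), and φ moves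
-- them into the right arm, which lies in λ(τ).  Both then output m and continue
-- on τ, with the stack and the labels pending for the right arm holding the
-- same letters.  Once τ lies in the tail it is increasing, λ(τ) is a right arm,
-- and both sides are the increasing arrangement of the remaining letters.  So
-- the common output is D₁ m₁ ⋯ Dₖ mₖ followed by an increasing run, with Dᵢ a
-- subword of σᵢ; its reduced word embeds into σ₁ m₁ ⋯ σₖ mₖ, which is part of
-- the reduced word of π, and hence still avoids 213.
module Submission where

open import Defs
open import Data.Bool using (true; false; if_then_else_)
open import Data.Empty using (⊥-elim)
open import Data.List using (List; []; _∷_; _++_; [_]; length; foldr; foldl; take; map; upTo)
open import Data.List.Properties using (++-assoc; ++-identityʳ; length-++; foldl-++; ∷-injective)
open import Data.List.Membership.Propositional using (_∈_; _∉_)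
open import Data.List.Membership.Propositional.Properties using (∈-++⁺ˡ; ∈-++⁺ʳ; ∈-++⁻; ∈-insert)
open import Data.List.Relation.Unary.All as All using (All; []; _∷_)
import Data.List.Relation.Unary.All.Properties as Allₚ
open import Data.List.Relation.Unary.Any using (here; there)
open import Data.List.Relation.Unary.AllPairs using (AllPairs; []; _∷_)
import Data.List.Relation.Unary.AllPairs as AllPairs
import Data.List.Relation.Unary.AllPairs.Properties as AllPairsₚ
open import Data.List.Relation.Unary.Unique.Propositional using (Unique)
import Data.List.Relation.Unary.Unique.Propositional.Properties as Uniqueₚ
open import Data.List.Relation.Binary.Sublist.Propositional
  using (_⊆_; []; _∷_; _∷ʳ_; ⊆-refl; ⊆-trans; minimum; from∈; lookup)
import Data.List.Relation.Binary.Sublist.Propositional.Properties as Sublistₚ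
open import Data.List.Relation.Binary.Permutation.Propositional
  using (_↭_; ↭-refl; ↭-sym; ↭-trans; ↭-prep; ↭-swap; ↭-reflexive; ↭⇒↭ₛ; module PermutationReasoning)
import Data.List.Relation.Binary.Permutation.Propositional.Properties as ↭ₚ
import Data.List.Relation.Binary.Permutation.Setoid.Properties as ↭ₛₚ
open import Data.Nat using (ℕ; zero; suc; _<_; _≤_; _<ᵇ_; _≡ᵇ_; s≤s⁻¹)
open import Data.Nat.Properties
open import Data.Product using (_×_; _,_; proj₁; proj₂; uncurry; ∃-syntax)
open import Data.Sum using (_⊎_; inj₁; inj₂)
open import Function using (_∘_; flip)
open import Relation.Binary.Definitions using (Reflexive; Transitive)
open import Relation.Nullary using (¬_)
open import Relation.Nullary.Reflects using (Reflects; ofʸ; ofⁿ; fromEquivalence)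
open import Relation.Binary.PropositionalEquality hiding ([_])
open import Algebra.Definitions {A = ℕ} _≡_ using (Selective)

private
  variable
    A : Set

Increasing : List ℕ → Set
Increasing = AllPairs _<_

infix 4 _≺_

_≺_ : List ℕ → List ℕ → Set
xs ≺ ys = All (λ x → All (x <_) ys) xs

<ᵇ≡true : ∀ {m n} → m < n → (m <ᵇ n) ≡ true
<ᵇ≡true {m} {n} m<n with m <ᵇ n | <ᵇ-reflects-< m n
... | true  | _ = refl
... | false | ofⁿ m≮n = ⊥-elim (m≮n m<n)

<ᵇ≡false : ∀ {m n} → ¬ m < n → (m <ᵇ n) ≡ false
<ᵇ≡false {m} {n} m≮n with m <ᵇ n | <ᵇ-reflects-< m n
... | false | _ = refl
... | true  | ofʸ m<n = ⊥-elim (m≮n m<n)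

≡ᵇ≡true : ∀ m → (m ≡ᵇ m) ≡ true
≡ᵇ≡true zero = refl
≡ᵇ≡true (suc m) = ≡ᵇ≡true m

≡ᵇ-reflects-≡ : ∀ m n → Reflects (m ≡ n) (m ≡ᵇ n)
≡ᵇ-reflects-≡ m n = fromEquivalence (≡ᵇ⇒≡ m n) (≡⇒≡ᵇ m n)

≡ᵇ≡false : ∀ {m n} → m ≢ n → (m ≡ᵇ n) ≡ false
≡ᵇ≡false {m} {n} m≢n with m ≡ᵇ n | ≡ᵇ-reflects-≡ m n
... | false | _        = refl
... | true  | ofʸ m≡n = ⊥-elim (m≢n m≡n)

Unique-resp-↭ : ∀ {xs ys : List A} → xs ↭ ys → Unique xs → Unique ys
Unique-resp-↭ p = ↭ₛₚ.Unique-resp-↭ (setoid _) (↭⇒↭ₛ p)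

Increasing⇒Unique : ∀ {xs} → Increasing xs → Unique xs
Increasing⇒Unique = AllPairs.map <⇒≢

AllPairs-++⁻ : ∀ {R : A → A → Set} xs {ys} → AllPairs R (xs ++ ys) →
               AllPairs R xs × AllPairs R ys × All (λ x → All (R x) ys) xs
AllPairs-++⁻ []       p       = [] , p , []
AllPairs-++⁻ (x ∷ xs) (p ∷ q) =
  let Rxs , Rys , Rxsys = AllPairs-++⁻ xs q
  in Allₚ.++⁻ˡ xs p ∷ Rxs , Rys , Allₚ.++⁻ʳ xs p ∷ Rxsys

AllPairs-resp-⊆ : ∀ {R : A → A → Set} {xs ys : List A} → xs ⊆ ys → AllPairs R ys → AllPairs R xs
AllPairs-resp-⊆ []          p       = p
AllPairs-resp-⊆ (_ ∷ʳ sub)  (_ ∷ p) = AllPairs-resp-⊆ sub p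
AllPairs-resp-⊆ (refl ∷ sub) (r ∷ p) = Sublistₚ.All-resp-⊆ sub r ∷ AllPairs-resp-⊆ sub p

Unique-++⁻ : ∀ (xs : List A) {ys} → Unique (xs ++ ys) → Unique xs × Unique ys × All (_∉ ys) xs
Unique-++⁻ xs u =
  let uxs , uys , disj = AllPairs-++⁻ xs u
  in uxs , uys , All.map (λ x≢ys x∈ys → All.lookup x≢ys x∈ys refl) disj

Unique-pivot : ∀ (σ : List A) {m τ} → Unique (σ ++ m ∷ τ) → All (_≢ m) σ × All (_≢ m) τ
Unique-pivot σ u with Unique-++⁻ σ u
... | _ , m≢τ ∷ _ , σ∉mτ = All.map (λ y∉ y≡m → y∉ (here y≡m)) σ∉mτ , All.map ≢-sym m≢τ

All-∉-sym : ∀ {xs ys : List A} → All (_∉ ys) xs → All (_∉ xs) ys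
All-∉-sym xs∉ys = All.tabulate λ y∈ys y∈xs → All.lookup xs∉ys y∈xs y∈ys

All-pivot⁻ : ∀ {P : A → Set} σ {m τ} → All P (σ ++ m ∷ τ) → All P σ × All P τ
All-pivot⁻ σ all = Allₚ.++⁻ˡ σ all , All.tail (Allₚ.++⁻ʳ σ all)

pivot-in-++ : ∀ (σ : List A) m τ F T → σ ++ m ∷ τ ≡ F ++ T →
  (∃[ c ] F ≡ σ ++ m ∷ c × τ ≡ c ++ T) ⊎
  (F ≡ σ × T ≡ m ∷ τ) ⊎
  (∃[ z ] ∃[ d ] σ ≡ F ++ z ∷ d × T ≡ z ∷ d ++ m ∷ τ)
pivot-in-++ []      m τ []      T eq = inj₂ (inj₁ (refl , sym eq))
pivot-in-++ (x ∷ σ) m τ []      T eq = inj₂ (inj₂ (x , σ , refl , sym eq))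
pivot-in-++ []      m τ (y ∷ F) T eq with ∷-injective eq
... | refl , τ≡ = inj₁ (F , refl , τ≡)
pivot-in-++ (x ∷ σ) m τ (y ∷ F) T eq with ∷-injective eq
... | refl , eq′ with pivot-in-++ σ m τ F T eq′
...   | inj₁ (c , F≡ , τ≡)               = inj₁ (c , cong (x ∷_) F≡ , τ≡)
...   | inj₂ (inj₁ (F≡ , T≡))            = inj₂ (inj₁ (cong (x ∷_) F≡ , T≡))
...   | inj₂ (inj₂ (z , d , σ≡ , T≡))    = inj₂ (inj₂ (z , d , cong (x ∷_) σ≡ , T≡))

≺-++⁺ʳ : ∀ {xs ys zs} → xs ≺ ys → xs ≺ zs → xs ≺ ys ++ zs
≺-++⁺ʳ p q = All.zipWith (λ (a , b) → Allₚ.++⁺ a b) (p , q)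

≺-resp-↭ʳ : ∀ {xs ys zs} → ys ↭ zs → xs ≺ ys → xs ≺ zs
≺-resp-↭ʳ p = All.map (↭ₚ.All-resp-↭ p)

≺-resp-⊆ʳ : ∀ {xs ys zs} → zs ⊆ ys → xs ≺ ys → xs ≺ zs
≺-resp-⊆ʳ sub = All.map (Sublistₚ.All-resp-⊆ sub)

Increasing-↭⇒≡ : ∀ {xs ys} → Increasing xs → Increasing ys → xs ↭ ys → xs ≡ ys
Increasing-↭⇒≡ {[]}     {[]}     _        _        _ = refl
Increasing-↭⇒≡ {[]}     {_ ∷ _}  _        _        p = ⊥-elim (↭ₚ.¬x∷xs↭[] (↭-sym p))
Increasing-↭⇒≡ {_ ∷ _}  {[]}     _        _        p = ⊥-elim (↭ₚ.¬x∷xs↭[] p)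
Increasing-↭⇒≡ {x ∷ xs} {y ∷ ys} (x< ∷ i) (y< ∷ j) p
  with ↭ₚ.∈-resp-↭ p (here refl) | ↭ₚ.∈-resp-↭ (↭-sym p) (here refl)
... | here refl | _         = cong (x ∷_) (Increasing-↭⇒≡ i j (↭ₚ.drop-∷ p))
... | there _   | here refl = cong (x ∷_) (Increasing-↭⇒≡ i j (↭ₚ.drop-∷ p))
... | there x∈ys | there y∈xs = ⊥-elim (<-asym (All.lookup x< y∈xs) (All.lookup y< x∈ys))

foldr-∈ : ∀ {_∙_ : ℕ → ℕ → ℕ} → Selective _∙_ → ∀ x xs → foldr _∙_ x xs ∈ x ∷ xs
foldr-∈ sel x [] = here refl
foldr-∈ {_∙_} sel x (y ∷ ys) with sel y (foldr _∙_ x ys) | foldr-∈ sel x ys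
... | inj₁ ≡y | _         = subst (_∈ x ∷ y ∷ ys) (sym ≡y) (there (here refl))
... | inj₂ ≡f | here ≡x   = here (trans ≡f ≡x)
... | inj₂ ≡f | there ∈ys = subst (_∈ x ∷ y ∷ ys) (sym ≡f) (there (there ∈ys))

foldr-bound : ∀ {_∙_ : ℕ → ℕ → ℕ} {_∼_ : ℕ → ℕ → Set} → Reflexive _∼_ → Transitive _∼_ →
              (∀ a b → a ∼ (a ∙ b)) → (∀ a b → b ∼ (a ∙ b)) →
              ∀ x xs → All (_∼ foldr _∙_ x xs) (x ∷ xs)
foldr-bound refl′ _     _ _ x [] = refl′ ∷ []
foldr-bound refl′ trans′ ∼ˡ ∼ʳ x (y ∷ ys) with foldr-bound refl′ trans′ ∼ˡ ∼ʳ x ys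
... | x∼ ∷ ys∼ = trans′ x∼ (∼ʳ y _) ∷ ∼ˡ y _ ∷ All.map (λ z∼ → trans′ z∼ (∼ʳ y _)) ys∼

-- Stacks are lists with the top first.  popBelow x st splits st into the
-- run of entries smaller than x, which x pops to the output, and the rest.
popBelow : ℕ → List ℕ → List ℕ × List ℕ
popBelow x [] = [] , []
popBelow x (y ∷ ys) =
  if y <ᵇ x then (y ∷ proj₁ (popBelow x ys) , proj₂ (popBelow x ys)) else ([] , y ∷ ys)

runStack : List ℕ → List ℕ → List ℕ × List ℕ
runStack st [] = [] , st
runStack st (x ∷ xs) =
  proj₁ (popBelow x st) ++ proj₁ (runStack (x ∷ proj₂ (popBelow x st)) xs) ,
  proj₂ (runStack (x ∷ proj₂ (popBelow x st)) xs)

stackSortFrom : List ℕ → List ℕ → List ℕ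
stackSortFrom st w = proj₁ (runStack st w) ++ proj₂ (runStack st w)

popBelow-none : ∀ {x} st → All (x <_) st → popBelow x st ≡ ([] , st)
popBelow-none []       _ = refl
popBelow-none (y ∷ ys) (x<y ∷ _) rewrite <ᵇ≡false (<⇒≯ x<y) = refl

popBelow-all : ∀ {x} st → All (_< x) st → popBelow x st ≡ (st , [])
popBelow-all []       _ = refl
popBelow-all (y ∷ ys) (y<x ∷ ys<x) rewrite <ᵇ≡true y<x | popBelow-all ys ys<x = refl

popBelow-above : ∀ {x} s b → All (x <_) b →
              popBelow x (s ++ b) ≡ (proj₁ (popBelow x s) , proj₂ (popBelow x s) ++ b)
popBelow-above [] b x<b = popBelow-none b x<b
popBelow-above {x} (y ∷ ys) b x<b with y <ᵇ x
... | true rewrite popBelow-above ys b x<b = refl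
... | false = refl

popBelow-++-id : ∀ x st → proj₁ (popBelow x st) ++ proj₂ (popBelow x st) ≡ st
popBelow-++-id x [] = refl
popBelow-++-id x (y ∷ ys) with y <ᵇ x
... | true  = cong (y ∷_) (popBelow-++-id x ys)
... | false = refl

popBelow-< : ∀ x st → All (_< x) (proj₁ (popBelow x st))
popBelow-< x [] = []
popBelow-< x (y ∷ ys) with y <ᵇ x | <ᵇ-reflects-< y x
... | true  | ofʸ y<x = y<x ∷ popBelow-< x ys
... | false | _       = []

popBelow->-rest : ∀ x st → Increasing st → x ∉ st → All (x <_) (proj₂ (popBelow x st))
popBelow->-rest x [] _ _ = []
popBelow->-rest x (y ∷ ys) (y< ∷ inc) x∉ with y <ᵇ x | <ᵇ-reflects-< y x
... | true  | _       = popBelow->-rest x ys inc (λ x∈ → x∉ (there x∈))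
... | false | ofⁿ y≮x = x<y ∷ All.map (<-trans x<y) y<
  where x<y = ≤∧≢⇒< (≮⇒≥ y≮x) (λ x≡y → x∉ (here x≡y))

runStack-++ : ∀ st a b →
  runStack st (a ++ b) ≡
    (proj₁ (runStack st a) ++ proj₁ (runStack (proj₂ (runStack st a)) b) ,
     proj₂ (runStack (proj₂ (runStack st a)) b))
runStack-++ st [] b = refl
runStack-++ st (x ∷ a) b rewrite runStack-++ (x ∷ proj₂ (popBelow x st)) a b =
  cong (_, proj₂ (runStack (proj₂ (runStack (x ∷ proj₂ (popBelow x st)) a)) b))
       (sym (++-assoc (proj₁ (popBelow x st)) _ _))

runStack-above : ∀ s b w → w ≺ b → runStack (s ++ b) w ≡ (proj₁ (runStack s w) , proj₂ (runStack s w) ++ b)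
runStack-above s b [] _ = refl
runStack-above s b (x ∷ xs) (x<b ∷ xs<b)
  rewrite popBelow-above s b x<b | runStack-above (x ∷ proj₂ (popBelow x s)) b xs xs<b = refl

runStack-pop-top : ∀ {m y} st ys → m < y →
  runStack (m ∷ st) (y ∷ ys) ≡ (m ∷ proj₁ (runStack st (y ∷ ys)) , proj₂ (runStack st (y ∷ ys)))
runStack-pop-top st ys m<y rewrite <ᵇ≡true m<y = refl

stackSortFrom-↭ : ∀ st w → stackSortFrom st w ↭ st ++ w
stackSortFrom-↭ st [] = ↭-reflexive (sym (++-identityʳ st))
stackSortFrom-↭ st (x ∷ xs) = begin
  (popped ++ out) ++ rest′       ≡⟨ ++-assoc popped out rest′ ⟩
  popped ++ (out ++ rest′)       ↭⟨ ↭ₚ.++⁺ˡ popped (stackSortFrom-↭ (x ∷ rest) xs) ⟩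
  popped ++ x ∷ rest ++ xs       ↭⟨ ↭ₚ.shift x popped (rest ++ xs) ⟩
  x ∷ popped ++ rest ++ xs       ≡⟨ cong (x ∷_) (sym (++-assoc popped rest xs)) ⟩
  x ∷ (popped ++ rest) ++ xs     ≡⟨ cong (λ s → x ∷ s ++ xs) (popBelow-++-id x st) ⟩
  x ∷ st ++ xs                   ↭⟨ ↭ₚ.shift x st xs ⟨
  st ++ x ∷ xs                   ∎
  where
  open PermutationReasoning
  popped = proj₁ (popBelow x st)
  rest   = proj₂ (popBelow x st)
  out    = proj₁ (runStack (x ∷ rest) xs)
  rest′  = proj₂ (runStack (x ∷ rest) xs)

runStack-All : ∀ {P : ℕ → Set} st w → All P st → All P w →
               All P (proj₁ (runStack st w)) × All P (proj₂ (runStack st w))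
runStack-All st w Pst Pw =
  Allₚ.++⁻ (proj₁ (runStack st w)) (↭ₚ.All-resp-↭ (↭-sym (stackSortFrom-↭ st w)) (Allₚ.++⁺ Pst Pw))

stackSortFrom-increasing : ∀ st w → Increasing st → Increasing w → All (_∉ w) st →
                           Increasing (stackSortFrom st w)
stackSortFrom-increasing st [] inc _ _ = inc
stackSortFrom-increasing st (y ∷ ys) inc (y< ∷ incys) st∉ =
  subst Increasing (sym (++-assoc popped out rest′))
    (AllPairsₚ.++⁺ (proj₁ (AllPairs-++⁻ popped inc′)) IH popped<)
  where
  popped = proj₁ (popBelow y st)
  rest   = proj₂ (popBelow y st)
  out    = proj₁ (runStack (y ∷ rest) ys)
  rest′  = proj₂ (runStack (y ∷ rest) ys)
  inc′ : Increasing (popped ++ rest)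
  inc′ = subst Increasing (sym (popBelow-++-id y st)) inc
  ∉′ : All (_∉ y ∷ ys) (popped ++ rest)
  ∉′ = subst (All (_∉ y ∷ ys)) (sym (popBelow-++-id y st)) st∉
  y<rest : All (y <_) rest
  y<rest = popBelow->-rest y st inc (λ y∈ → All.lookup st∉ y∈ (here refl))
  IH : Increasing (stackSortFrom (y ∷ rest) ys)
  IH = stackSortFrom-increasing (y ∷ rest) ys (y<rest ∷ proj₁ (proj₂ (AllPairs-++⁻ popped inc′))) incys
         ((λ y∈ys → <-irrefl refl (All.lookup y< y∈ys)) ∷
          All.map (λ z∉ z∈ → z∉ (there z∈)) (Allₚ.++⁻ʳ popped ∉′))
  popped< : popped ≺ stackSortFrom (y ∷ rest) ys
  popped< = All.tabulate λ {z} z∈ →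
    let z<y = All.lookup (popBelow-< y st) z∈ in
    ↭ₚ.All-resp-↭ (↭-sym (stackSortFrom-↭ (y ∷ rest) ys))
      (z<y ∷ Allₚ.++⁺ (All.lookup (proj₂ (proj₂ (AllPairs-++⁻ popped inc′))) z∈) (All.map (<-trans z<y) y<))

stackSortFrom-push-min : ∀ {m} s w → All (m <_) w → stackSortFrom (m ∷ s) w ≡ m ∷ stackSortFrom s w
stackSortFrom-push-min s []       _         = refl
stackSortFrom-push-min s (y ∷ ys) (m<y ∷ _) = cong (λ r → proj₁ r ++ proj₂ r) (runStack-pop-top s ys m<y)

runStack-pivot : ∀ {st a m w D s} → runStack st a ≡ (D , s) → All (m <_) s →
  runStack st (a ++ m ∷ w) ≡ (D ++ proj₁ (runStack (m ∷ s) w) , proj₂ (runStack (m ∷ s) w))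
runStack-pivot {st} {a} {m} {w} run≡ m<s
  rewrite runStack-++ st a (m ∷ w) | run≡ | popBelow-none _ m<s = refl

stackSortFrom-pivot : ∀ {st σ m τ D s} → runStack st σ ≡ (D , s) → All (m <_) s → All (m <_) τ →
                      stackSortFrom st (σ ++ m ∷ τ) ≡ D ++ m ∷ stackSortFrom s τ
stackSortFrom-pivot {st} {σ} {m} {τ} {D} {s} run≡ m<s m<τ = begin
  stackSortFrom st (σ ++ m ∷ τ)                  ≡⟨ cong (λ r → proj₁ r ++ proj₂ r) (runStack-pivot run≡ m<s) ⟩
  (D ++ proj₁ (runStack (m ∷ s) τ)) ++ proj₂ (runStack (m ∷ s) τ) ≡⟨ ++-assoc D _ _ ⟩
  D ++ stackSortFrom (m ∷ s) τ                   ≡⟨ cong (D ++_) (stackSortFrom-push-min s τ m<τ) ⟩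
  D ++ m ∷ stackSortFrom s τ                     ∎
  where open ≡-Reasoning

stackSortFrom-max : ∀ {M} a b → All (_< M) a → All (_< M) b →
  stackSortFrom [] (a ++ M ∷ b) ≡ stackSortFrom [] a ++ stackSortFrom [] b ++ [ M ]
stackSortFrom-max {M} a b a<M b<M
  rewrite runStack-++ [] a (M ∷ b)
        | popBelow-all {M} (proj₂ (runStack [] a)) (proj₂ (runStack-All [] a [] a<M))
        | runStack-above [] [ M ] b (All.map (_∷ []) b<M) = begin
  (o₁ ++ s₁ ++ o₂) ++ s₂ ++ [ M ]     ≡⟨ ++-assoc o₁ (s₁ ++ o₂) _ ⟩
  o₁ ++ (s₁ ++ o₂) ++ s₂ ++ [ M ]     ≡⟨ cong (o₁ ++_) (++-assoc s₁ o₂ _) ⟩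
  o₁ ++ s₁ ++ o₂ ++ s₂ ++ [ M ]       ≡⟨ sym (++-assoc o₁ s₁ _) ⟩
  (o₁ ++ s₁) ++ o₂ ++ s₂ ++ [ M ]     ≡⟨ cong ((o₁ ++ s₁) ++_) (sym (++-assoc o₂ s₂ _)) ⟩
  (o₁ ++ s₁) ++ (o₂ ++ s₂) ++ [ M ]   ∎
  where
  open ≡-Reasoning
  o₁ = proj₁ (runStack [] a)
  s₁ = proj₂ (runStack [] a)
  o₂ = proj₁ (runStack [] b)
  s₂ = proj₂ (runStack [] b)

splitOn-≡ : ∀ {m} w → m ∈ w → w ≡ proj₁ (splitOn m w) ++ m ∷ proj₂ (splitOn m w)
splitOn-≡ {m} (x ∷ xs) m∈ with m ≡ᵇ x | ≡ᵇ-reflects-≡ m x | m∈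
... | true  | ofʸ refl | _          = refl
... | false | ofⁿ m≢x  | here m≡x   = ⊥-elim (m≢x m≡x)
... | false | _        | there m∈xs = cong (x ∷_) (splitOn-≡ xs m∈xs)

splitOn-pivot : ∀ {f m} w → m ∈ w → length w ≤ suc f →
  let σ = proj₁ (splitOn m w) ; τ = proj₂ (splitOn m w) in w ≡ σ ++ m ∷ τ × length σ ≤ f × length τ ≤ f
splitOn-pivot {m = m} w m∈ le =
  w≡ , length-pivot σ m τ (subst (λ v → length v ≤ _) w≡ le)
  where
  σ = proj₁ (splitOn m w)
  τ = proj₂ (splitOn m w)
  w≡ = splitOn-≡ w m∈
  length-pivot : ∀ {f} (σ : List ℕ) m τ → length (σ ++ m ∷ τ) ≤ suc f → length σ ≤ f × length τ ≤ f
  length-pivot σ m τ le rewrite length-++ σ {m ∷ τ} | +-suc (length σ) (length τ) =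
    m+n≤o⇒m≤o (length σ) (s≤s⁻¹ le) , m+n≤o⇒n≤o (length σ) (s≤s⁻¹ le)

data SortSplit : ℕ → List ℕ → Set where
  []    : ∀ {f} → SortSplit f []
  split : ∀ {f} σ M τ → length σ ≤ f → length τ ≤ f → All (_≤ M) (σ ++ M ∷ τ) →
          stackSortF (suc f) (σ ++ M ∷ τ) ≡ stackSortF f σ ++ stackSortF f τ ++ [ M ] →
          SortSplit (suc f) (σ ++ M ∷ τ)

sortSplit : ∀ f w → length w ≤ f → SortSplit f w
sortSplit f       []       _  = []
sortSplit (suc f) (x ∷ xs) le with splitOn-pivot (x ∷ xs) (foldr-∈ ⊔-sel x xs) le
... | w≡ , |σ|≤ , |τ|≤ = subst (SortSplit (suc f)) (sym w≡)
  (split σ M τ |σ|≤ |τ|≤ (subst (All (_≤ M)) w≡ (foldr-bound ≤-refl ≤-trans m≤m⊔n m≤n⊔m x xs))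
    (subst (λ w → stackSortF (suc f) w ≡ stackSortF f σ ++ stackSortF f τ ++ [ M ]) w≡ refl))
  where
  M = maxL x xs
  σ = proj₁ (splitOn M (x ∷ xs))
  τ = proj₂ (splitOn M (x ∷ xs))

data LamSplit : ℕ → List ℕ → Set where
  []    : ∀ {f} → LamSplit f []
  split : ∀ {f} σ m τ → length σ ≤ f → length τ ≤ f → All (m ≤_) (σ ++ m ∷ τ) →
          lamF (suc f) (σ ++ m ∷ τ) ≡ node (lamF f σ) m (lamF f τ) →
          LamSplit (suc f) (σ ++ m ∷ τ)

lamSplit : ∀ f w → length w ≤ f → LamSplit f w
lamSplit f       []       _  = []
lamSplit (suc f) (x ∷ xs) le with splitOn-pivot (x ∷ xs) (foldr-∈ ⊓-sel x xs) le
... | w≡ , |σ|≤ , |τ|≤ = subst (LamSplit (suc f)) (sym w≡)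
  (split σ m τ |σ|≤ |τ|≤ (subst (All (m ≤_)) w≡ (foldr-bound ≤-refl (flip ≤-trans) m⊓n≤m m⊓n≤n x xs))
    (subst (λ w → lamF (suc f) w ≡ node (lamF f σ) m (lamF f τ)) w≡ refl))
  where
  m = minL x xs
  σ = proj₁ (splitOn m (x ∷ xs))
  τ = proj₂ (splitOn m (x ∷ xs))

pivot-max : ∀ σ {M τ} → Unique (σ ++ M ∷ τ) → All (_≤ M) (σ ++ M ∷ τ) → All (_< M) σ × All (_< M) τ
pivot-max σ u ≤M with Unique-pivot σ u | All-pivot⁻ σ ≤M
... | σ≢ , τ≢ | σ≤ , τ≤ = strict σ≤ σ≢ , strict τ≤ τ≢
  where strict = λ {xs} (p : All _ xs) q → All.zipWith (uncurry ≤∧≢⇒<) (p , q)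

pivot-min : ∀ σ {m τ} → Unique (σ ++ m ∷ τ) → All (m ≤_) (σ ++ m ∷ τ) → All (m <_) σ × All (m <_) τ
pivot-min σ u m≤ with Unique-pivot σ u | All-pivot⁻ σ m≤
... | σ≢ , τ≢ | ≤σ , ≤τ = strict ≤σ σ≢ , strict ≤τ τ≢
  where strict = λ {xs} (p : All _ xs) q → All.zipWith (λ (a , b) → ≤∧≢⇒< a (≢-sym b)) (p , q)

stackSortF-[] : ∀ f → stackSortF f [] ≡ []
stackSortF-[] zero    = refl
stackSortF-[] (suc _) = refl

stackSortF≡stackSortFrom : ∀ f w → length w ≤ f → Unique w → stackSortF f w ≡ stackSortFrom [] w
stackSortF≡stackSortFrom f w le u with sortSplit f w le
... | [] = stackSortF-[] f
... | split {f} σ M τ |σ|≤ |τ|≤ ≤M sort≡ with Unique-++⁻ σ u | pivot-max σ u ≤M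
...   | uσ , _ ∷ uτ , _ | σ<M , τ<M = begin
  stackSortF (suc f) (σ ++ M ∷ τ)                  ≡⟨ sort≡ ⟩
  stackSortF f σ ++ stackSortF f τ ++ [ M ]         ≡⟨ cong₂ (λ a b → a ++ b ++ [ M ])
                                                         (stackSortF≡stackSortFrom f σ |σ|≤ uσ)
                                                         (stackSortF≡stackSortFrom f τ |τ|≤ uτ) ⟩
  stackSortFrom [] σ ++ stackSortFrom [] τ ++ [ M ] ≡⟨ stackSortFrom-max σ τ σ<M τ<M ⟨
  stackSortFrom [] (σ ++ M ∷ τ)                    ∎
  where open ≡-Reasoning

inorderWithRightChild : Tree → List ℕ
inorderWithRightChild leaf                       = []
inorderWithRightChild (node l x leaf)            = inorderWithRightChild l
inorderWithRightChild (node l x r@(node _ _ _))  = inorderWithRightChild l ++ x ∷ inorderWithRightChild r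

inorderWithRightChild-node : ∀ l x r → r ≢ leaf →
  inorderWithRightChild (node l x r) ≡ inorderWithRightChild l ++ x ∷ inorderWithRightChild r
inorderWithRightChild-node l x leaf         r≢leaf = ⊥-elim (r≢leaf refl)
inorderWithRightChild-node l x (node _ _ _) _      = refl

noRightChild-node : ∀ l x r → r ≢ leaf → noRightChild (node l x r) ≡ noRightChild l ++ noRightChild r
noRightChild-node l x leaf         r≢leaf = ⊥-elim (r≢leaf refl)
noRightChild-node l x (node _ _ _) _      = refl

noRightChild-⊆ : ∀ t → noRightChild t ⊆ inorder t
noRightChild-⊆ leaf                      = []
noRightChild-⊆ (node l x leaf)           = Sublistₚ.++⁺ (noRightChild-⊆ l) (refl ∷ [])
noRightChild-⊆ (node l x r@(node _ _ _)) = Sublistₚ.++⁺ (noRightChild-⊆ l) (x ∷ʳ noRightChild-⊆ r)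

inorderWithRightChild-⊆ : ∀ t → inorderWithRightChild t ⊆ inorder t
inorderWithRightChild-⊆ leaf                      = []
inorderWithRightChild-⊆ (node l x leaf)           = Sublistₚ.++⁺ʳ [ x ] (inorderWithRightChild-⊆ l)
inorderWithRightChild-⊆ (node l x r@(node _ _ _)) =
  Sublistₚ.++⁺ (inorderWithRightChild-⊆ l) (refl ∷ inorderWithRightChild-⊆ r)

rightLeaves-⊆ : ∀ t → rightLeaves t ⊆ inorder t
rightLeaves-⊆ leaf         = []
rightLeaves-⊆ (node l x r) = Sublistₚ.++⁺ (noRightChild-⊆ l) (x ∷ʳ rightLeaves-⊆ r)

removeAll : List ℕ → Tree → Tree
removeAll vs t = foldl (λ s v → removeNode v s) t vs

insertAll : List ℕ → Tree → Tree
insertAll vs t = foldl (λ s v → insertArm v s) t vs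

phiAll : List ℕ → Tree → Tree
phiAll vs t = foldl (λ s v → phi v s) t vs

-- Below a node of T, E collects the right leaves of the left subtrees of its
-- ancestors, which Φ moves into the right arm; Phi t is PhiWith [] t.
PhiWith : List ℕ → Tree → Tree
PhiWith E t = phiAll (rightLeaves t) (insertAll E t)

removeNode-∉ : ∀ v t → v ∉ inorder t → removeNode v t ≡ t
removeNode-∉ v leaf         _   = refl
removeNode-∉ v (node l x r) v∉ rewrite ≡ᵇ≡false {v} {x} (λ { refl → v∉ (∈-insert (inorder l)) }) =
  cong₂ (λ l′ r′ → node l′ x r′) (removeNode-∉ v l (λ v∈ → v∉ (∈-++⁺ˡ v∈)))
                                  (removeNode-∉ v r (λ v∈ → v∉ (∈-++⁺ʳ (inorder l) (there v∈))))

removeNode-root : ∀ {l r} x → removeNode x (node l x r) ≡ l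
removeNode-root x rewrite ≡ᵇ≡true x = refl

removeAll-∉ : ∀ vs t → All (_∉ inorder t) vs → removeAll vs t ≡ t
removeAll-∉ []       t _            = refl
removeAll-∉ (v ∷ vs) t (v∉ ∷ vs∉) rewrite removeNode-∉ v t v∉ = removeAll-∉ vs t vs∉

removeAll-node : ∀ vs l x r → All (_≢ x) vs → removeAll vs (node l x r) ≡ node (removeAll vs l) x (removeAll vs r)
removeAll-node []       l x r _ = refl
removeAll-node (v ∷ vs) l x r (v≢x ∷ vs≢x) rewrite ≡ᵇ≡false v≢x =
  removeAll-node vs (removeNode v l) x (removeNode v r) vs≢x

removeAll-++ : ∀ us vs t → removeAll (us ++ vs) t ≡ removeAll vs (removeAll us t)
removeAll-++ us vs t = foldl-++ (λ s v → removeNode v s) t us vs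

removeNode-⊆ : ∀ v t → inorder (removeNode v t) ⊆ inorder t
removeNode-⊆ v leaf = []
removeNode-⊆ v (node l x r) with v ≡ᵇ x
... | true  = Sublistₚ.++⁺ʳ (x ∷ inorder r) ⊆-refl
... | false = Sublistₚ.++⁺ (removeNode-⊆ v l) (refl ∷ removeNode-⊆ v r)

removeAll-⊆ : ∀ vs t → inorder (removeAll vs t) ⊆ inorder t
removeAll-⊆ []       t = ⊆-refl
removeAll-⊆ (v ∷ vs) t = ⊆-trans (removeAll-⊆ vs (removeNode v t)) (removeNode-⊆ v t)

removeAll-++-∉ : ∀ us vs t → All (_∉ inorder t) vs → removeAll (us ++ vs) t ≡ removeAll us t
removeAll-++-∉ us vs t vs∉ = trans (removeAll-++ us vs t)
  (removeAll-∉ vs (removeAll us t) (All.map (λ v∉ v∈ → v∉ (lookup (removeAll-⊆ us t) v∈)) vs∉))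

removeAll-noRightChild : ∀ t → Unique (inorder t) →
  inorder (removeAll (noRightChild t) t) ≡ inorderWithRightChild t
removeAll-noRightChild leaf _ = refl
removeAll-noRightChild (node l x leaf) u = begin
  inorder (removeAll (noRightChild l ++ [ x ]) (node l x leaf))
    ≡⟨ cong inorder (removeAll-++ (noRightChild l) [ x ] (node l x leaf)) ⟩
  inorder (removeNode x (removeAll (noRightChild l) (node l x leaf)))
    ≡⟨ cong (inorder ∘ removeNode x)
            (removeAll-node (noRightChild l) l x leaf (Sublistₚ.All-resp-⊆ (noRightChild-⊆ l) l≢x)) ⟩
  inorder (removeNode x (node (removeAll (noRightChild l) l) x (removeAll (noRightChild l) leaf)))
    ≡⟨ cong inorder (removeNode-root x) ⟩
  inorder (removeAll (noRightChild l) l)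
    ≡⟨ removeAll-noRightChild l (proj₁ (Unique-++⁻ (inorder l) u)) ⟩
  inorderWithRightChild l ∎
  where
  open ≡-Reasoning
  l≢x = proj₁ (Unique-pivot (inorder l) u)
removeAll-noRightChild (node l x r@(node _ _ _)) u = begin
  inorder (removeAll (Nl ++ Nr) (node l x r))
    ≡⟨ cong inorder (removeAll-node (Nl ++ Nr) l x r
         (Allₚ.++⁺ (Sublistₚ.All-resp-⊆ (noRightChild-⊆ l) l≢x) (Sublistₚ.All-resp-⊆ (noRightChild-⊆ r) r≢x))) ⟩
  inorder (removeAll (Nl ++ Nr) l) ++ x ∷ inorder (removeAll (Nl ++ Nr) r)
    ≡⟨ cong₂ (λ a b → inorder a ++ x ∷ inorder b)
         (removeAll-++-∉ Nl Nr l (Sublistₚ.All-resp-⊆ (noRightChild-⊆ r) r∉l))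
         (trans (removeAll-++ Nl Nr r)
                (cong (removeAll Nr) (removeAll-∉ Nl r (Sublistₚ.All-resp-⊆ (noRightChild-⊆ l) l∉r)))) ⟩
  inorder (removeAll Nl l) ++ x ∷ inorder (removeAll Nr r)
    ≡⟨ cong₂ (λ a b → a ++ x ∷ b) (removeAll-noRightChild l ul) (removeAll-noRightChild r ur) ⟩
  inorderWithRightChild l ++ x ∷ inorderWithRightChild r ∎
  where
  open ≡-Reasoning
  Nl = noRightChild l
  Nr = noRightChild r
  l≢x = proj₁ (Unique-pivot (inorder l) u)
  r≢x = proj₂ (Unique-pivot (inorder l) u)
  parts = Unique-++⁻ (inorder l) u
  ul = proj₁ parts
  ur = proj₁ (proj₂ (Unique-++⁻ [ x ] (proj₁ (proj₂ parts))))
  l∉r : All (_∉ inorder r) (inorder l)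
  l∉r = All.map (λ y∉ y∈ → y∉ (there y∈)) (proj₂ (proj₂ parts))
  r∉l : All (_∉ inorder l) (inorder r)
  r∉l = All-∉-sym l∉r

insertArm-↭ : ∀ v t → inorder (insertArm v t) ↭ v ∷ inorder t
insertArm-↭ v leaf = ↭-refl
insertArm-↭ v (node l x r) with v <ᵇ x
... | true  = ↭-refl
... | false = begin
  inorder l ++ x ∷ inorder (insertArm v r)   ↭⟨ ↭ₚ.++⁺ˡ (inorder l) (↭-prep x (insertArm-↭ v r)) ⟩
  inorder l ++ x ∷ v ∷ inorder r             ↭⟨ ↭ₚ.++⁺ˡ (inorder l) (↭-swap x v ↭-refl) ⟩
  inorder l ++ v ∷ x ∷ inorder r             ↭⟨ ↭ₚ.shift v (inorder l) (x ∷ inorder r) ⟩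
  v ∷ inorder l ++ x ∷ inorder r             ∎
  where open PermutationReasoning

insertAll-↭ : ∀ E t → inorder (insertAll E t) ↭ E ++ inorder t
insertAll-↭ []      t = ↭-refl
insertAll-↭ (v ∷ E) t = begin
  inorder (insertAll E (insertArm v t))   ↭⟨ insertAll-↭ E (insertArm v t) ⟩
  E ++ inorder (insertArm v t)            ↭⟨ ↭ₚ.++⁺ˡ E (insertArm-↭ v t) ⟩
  E ++ v ∷ inorder t                      ↭⟨ ↭ₚ.shift v E (inorder t) ⟩
  v ∷ E ++ inorder t                      ∎
  where open PermutationReasoning

insertAll-∉ : ∀ {y} E t → y ∉ E → y ∉ inorder t → y ∉ inorder (insertAll E t)
insertAll-∉ E t y∉E y∉t y∈ with ∈-++⁻ E (↭ₚ.∈-resp-↭ (insertAll-↭ E t) y∈)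
... | inj₁ y∈E = y∉E y∈E
... | inj₂ y∈t = y∉t y∈t

insertAll-node : ∀ E l m r → All (m <_) E → insertAll E (node l m r) ≡ node l m (insertAll E r)
insertAll-node []      l m r _ = refl
insertAll-node (v ∷ E) l m r (m<v ∷ m<E) rewrite <ᵇ≡false {v} {m} (<⇒≯ m<v) =
  insertAll-node E l m (insertArm v r) m<E

-- Applying φ_v for the right leaves v of the left subtree L: each leaves L and
-- joins the right arm, which lies in R since m is smaller than all of them.
phiAll-node-left : ∀ vs L m R → Unique vs → All (m <_) vs → All (_∉ inorder R) vs →
  phiAll vs (node L m R) ≡ node (removeAll vs L) m (insertAll vs R)
phiAll-node-left []       L m R _ _ _ = refl
phiAll-node-left (v ∷ vs) L m R (v≢ ∷ u) (m<v ∷ m<vs) (v∉R ∷ vs∉R)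
  rewrite ≡ᵇ≡false {v} {m} (≢-sym (<⇒≢ m<v)) | removeNode-∉ v R v∉R | <ᵇ≡false {v} {m} (<⇒≯ m<v) =
  phiAll-node-left vs (removeNode v L) m (insertArm v R) u m<vs
    (All.zipWith (λ (y∉R , v≢y) → insertAll-∉ [ v ] R (λ { (here refl) → v≢y refl }) y∉R) (vs∉R , v≢))

phiAll-node-right : ∀ vs L m X → All (m <_) vs → All (_∉ inorder L) vs →
  phiAll vs (node L m X) ≡ node L m (phiAll vs X)
phiAll-node-right []       L m X _ _ = refl
phiAll-node-right (v ∷ vs) L m X (m<v ∷ m<vs) (v∉L ∷ vs∉L)
  rewrite ≡ᵇ≡false {v} {m} (≢-sym (<⇒≢ m<v)) | removeNode-∉ v L v∉L | <ᵇ≡false {v} {m} (<⇒≯ m<v) =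
  phiAll-node-right vs L m (insertArm v (removeNode v X)) m<vs vs∉L

PhiWith-node : ∀ E l m r → All (m <_) E → All (m <_) (inorder l) → All (m <_) (inorder r) →
  Unique (inorder l ++ inorder r) → All (_∉ E) (inorder l) →
  inorder (PhiWith E (node l m r)) ≡ inorderWithRightChild l ++ m ∷ inorder (PhiWith (E ++ noRightChild l) r)
PhiWith-node E l m r m<E m<l m<r u l∉E = begin
  inorder (phiAll (Nl ++ rightLeaves r) (insertAll E (node l m r)))
    ≡⟨ cong (inorder ∘ phiAll (Nl ++ rightLeaves r)) (insertAll-node E l m r m<E) ⟩
  inorder (phiAll (Nl ++ rightLeaves r) (node l m (insertAll E r)))
    ≡⟨ cong inorder (foldl-++ (λ s v → phi v s) (node l m (insertAll E r)) Nl (rightLeaves r)) ⟩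
  inorder (phiAll (rightLeaves r) (phiAll Nl (node l m (insertAll E r))))
    ≡⟨ cong (inorder ∘ phiAll (rightLeaves r))
            (phiAll-node-left Nl l m (insertAll E r) (AllPairs-resp-⊆ (noRightChild-⊆ l) ul)
              (Sublistₚ.All-resp-⊆ (noRightChild-⊆ l) m<l) (Sublistₚ.All-resp-⊆ (noRightChild-⊆ l) l∉E+r)) ⟩
  inorder (phiAll (rightLeaves r) (node (removeAll Nl l) m (insertAll Nl (insertAll E r))))
    ≡⟨ cong inorder (phiAll-node-right (rightLeaves r) (removeAll Nl l) m _
            (Sublistₚ.All-resp-⊆ (rightLeaves-⊆ r) m<r) (Sublistₚ.All-resp-⊆ (rightLeaves-⊆ r) r∉l′)) ⟩
  inorder (removeAll Nl l) ++ m ∷ inorder (phiAll (rightLeaves r) (insertAll Nl (insertAll E r)))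
    ≡⟨ cong₂ (λ a b → a ++ m ∷ inorder (phiAll (rightLeaves r) b))
            (removeAll-noRightChild l ul) (sym (foldl-++ (λ s v → insertArm v s) r E Nl)) ⟩
  inorderWithRightChild l ++ m ∷ inorder (PhiWith (E ++ Nl) r) ∎
  where
  open ≡-Reasoning
  Nl = noRightChild l
  parts = Unique-++⁻ (inorder l) u
  ul = proj₁ parts
  l∉E+r : All (_∉ inorder (insertAll E r)) (inorder l)
  l∉E+r = All.zipWith (λ (y∉E , y∉r) → insertAll-∉ E r y∉E y∉r) (l∉E , proj₂ (proj₂ parts))
  r∉l′ : All (_∉ inorder (removeAll Nl l)) (inorder r)
  r∉l′ = All.map (λ y∉l y∈ → y∉l (lookup (removeAll-⊆ Nl l) y∈)) (All-∉-sym (proj₂ (proj₂ parts)))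

data RightArm : Tree → Set where
  leaf : RightArm leaf
  node : ∀ {x r} → RightArm r → RightArm (node leaf x r)

rightLeaves-RightArm : ∀ {t} → RightArm t → rightLeaves t ≡ []
rightLeaves-RightArm leaf     = refl
rightLeaves-RightArm (node a) = rightLeaves-RightArm a

insertArm-RightArm : ∀ v {t} → RightArm t → Increasing (inorder t) → v ∉ inorder t →
                     RightArm (insertArm v t) × Increasing (inorder (insertArm v t))
insertArm-RightArm v leaf _ _ = node leaf , [] ∷ []
insertArm-RightArm v {node leaf x r} (node a) (x< ∷ inc) v∉ with v <ᵇ x | <ᵇ-reflects-< v x
... | true  | ofʸ v<x = node (node a) , (v<x ∷ All.map (<-trans v<x) x<) ∷ x< ∷ inc
... | false | ofⁿ v≮x =
  let a′ , inc′ = insertArm-RightArm v a inc (λ v∈ → v∉ (there v∈)) in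
  node a′ , ↭ₚ.All-resp-↭ (↭-sym (insertArm-↭ v r)) (x<v ∷ x<) ∷ inc′
  where x<v = ≤∧≢⇒< (≮⇒≥ v≮x) (λ x≡v → v∉ (here (sym x≡v)))

insertAll-RightArm : ∀ E {t} → RightArm t → Increasing (inorder t) → Unique E → All (_∉ inorder t) E →
                     RightArm (insertAll E t) × Increasing (inorder (insertAll E t))
insertAll-RightArm []      a inc _ _ = a , inc
insertAll-RightArm (v ∷ E) {t} a inc (v≢E ∷ u) (v∉ ∷ E∉) =
  let a′ , inc′ = insertArm-RightArm v a inc v∉ in
  insertAll-RightArm E a′ inc′ u
    (All.zipWith (λ (v≢y , y∉) → insertAll-∉ [ v ] t (λ { (here refl) → v≢y refl }) y∉) (v≢E , E∉))

PhiWith-RightArm : ∀ E {t} → RightArm t → PhiWith E t ≡ insertAll E t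
PhiWith-RightArm E a rewrite rightLeaves-RightArm a = refl

lamF-[] : ∀ f → lamF f [] ≡ leaf
lamF-[] zero    = refl
lamF-[] (suc f) = refl

lamF-≢leaf : ∀ {f y ys} → length (y ∷ ys) ≤ f → lamF f (y ∷ ys) ≢ leaf
lamF-≢leaf {suc f} _ ()

inorder-lamF : ∀ f w → length w ≤ f → inorder (lamF f w) ≡ w
inorder-lamF f w le with lamSplit f w le
... | [] = cong inorder (lamF-[] f)
... | split {f} σ m τ |σ|≤ |τ|≤ _ lamF≡ rewrite lamF≡ =
  cong₂ (λ a b → a ++ m ∷ b) (inorder-lamF f σ |σ|≤) (inorder-lamF f τ |τ|≤)

noRightChild-lamF-⊆ : ∀ f w → length w ≤ f → noRightChild (lamF f w) ⊆ w
noRightChild-lamF-⊆ f w le = subst (noRightChild (lamF f w) ⊆_) (inorder-lamF f w le) (noRightChild-⊆ (lamF f w))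

lamF-RightArm : ∀ f w → length w ≤ f → Increasing w → RightArm (lamF f w)
lamF-RightArm f w le inc with lamSplit f w le
... | [] rewrite lamF-[] f = leaf
... | split {f} []      m τ _ |τ|≤ _ lamF≡ rewrite lamF≡ | lamF-[] f =
  node (lamF-RightArm f τ |τ|≤ (proj₁ (proj₂ (AllPairs-++⁻ [ m ] inc))))
... | split (y ∷ σ) m τ _ _ (m≤y ∷ _) _ with inc
...   | y< ∷ _ = ⊥-elim (<⇒≱ (All.lookup y< (∈-insert σ)) m≤y)

Avoids213-⊆ : ∀ {xs ys} → xs ⊆ ys → Avoids213 ys → Avoids213 xs
Avoids213-⊆ sub avoids (a , b , c , bac⊆ , a<b , b<c) = avoids (a , b , c , ⊆-trans bac⊆ sub , a<b , b<c)

-- Otherwise x m y with x ∈ σ, y ∈ τ, x < y would be a 213.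
Avoids213-pivot : ∀ σ {m τ} → Avoids213 (σ ++ m ∷ τ) → Unique (σ ++ m ∷ τ) → All (m <_) σ → τ ≺ σ
Avoids213-pivot σ {m} {τ} avoids u m<σ = All.tabulate λ {y} y∈τ → All.tabulate λ {x} x∈σ →
  ≤∧≢⇒< (≮⇒≥ λ x<y →
           avoids (m , x , y , Sublistₚ.++⁺ (from∈ x∈σ) (refl ∷ from∈ y∈τ) , All.lookup m<σ x∈σ , x<y))
        (λ { refl → All.lookup (proj₂ (proj₂ (Unique-++⁻ σ u))) x∈σ (there y∈τ) })

splitTail-correct : ∀ w → proj₁ (splitTail w) ++ proj₂ (splitTail w) ≡ w × Increasing (proj₂ (splitTail w))
splitTail-correct [] = refl , []
splitTail-correct (x ∷ xs) with splitTail xs | splitTail-correct xs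
... | [] , []      | ≡xs , _ = cong (x ∷_) ≡xs , [] ∷ []
... | [] , (y ∷ t) | ≡xs , (y< ∷ inc) with x <ᵇ y | <ᵇ-reflects-< x y
...   | true  | ofʸ x<y = cong (x ∷_) ≡xs , (x<y ∷ All.map (<-trans x<y) y<) ∷ y< ∷ inc
...   | false | _       = cong (x ∷_) ≡xs , y< ∷ inc
splitTail-correct (x ∷ xs) | (z ∷ f) , t | ≡xs , inc = cong (x ∷_) ≡xs , inc

splitTail-Increasing : ∀ {w} → Increasing w → splitTail w ≡ ([] , w)
splitTail-Increasing {[]}         _             = refl
splitTail-Increasing {x ∷ []}     _             = refl
splitTail-Increasing {x ∷ y ∷ ys} ((x<y ∷ _) ∷ inc)
  rewrite splitTail-Increasing {y ∷ ys} inc | <ᵇ≡true x<y = refl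

reduceTail-Increasing : ∀ {w} → Increasing w → reduceTail w ≡ take 1 w
reduceTail-Increasing {w} inc rewrite splitTail-Increasing inc = refl

reduceTail-∷ : ∀ x w → reduceTail (x ∷ w) ⊆ x ∷ reduceTail w
reduceTail-∷ x w with splitTail w
... | [] , []      = ⊆-refl
... | [] , (y ∷ t) with x <ᵇ y
...   | true  = refl ∷ minimum _
...   | false = ⊆-refl
reduceTail-∷ x w | (z ∷ f) , t = ⊆-refl

reduceTail-++ : ∀ A w → reduceTail (A ++ w) ⊆ A ++ reduceTail w
reduceTail-++ []      w = ⊆-refl
reduceTail-++ (x ∷ A) w = ⊆-trans (reduceTail-∷ x (A ++ w)) (refl ∷ reduceTail-++ A w)

record PartialRun (st : List ℕ) (t : Tree) (σ : List ℕ) : Set where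
  field
    pushed     : List ℕ
    runs       : runStack st σ ≡ (inorderWithRightChild t , pushed ++ st)
    increasing : Increasing pushed
    pushed↭    : pushed ↭ noRightChild t

PartialRun-pivot : ∀ {f st ta a m} b (ra : PartialRun st ta a) → let S = PartialRun.pushed ra in
  length b ≤ f → All (m <_) (S ++ st) → All (m <_) b → b ≺ S ++ st →
  (∀ {st′} → b ≺ st′ → PartialRun st′ (lamF f b) b) →
  PartialRun st (node ta m (lamF f b)) (a ++ m ∷ b)
PartialRun-pivot {f} {st} {ta} {a} {m} [] ra _ m<S+st _ _ _ rewrite lamF-[] f = record
  { pushed     = m ∷ S
  ; runs       = trans (runStack-pivot runs m<S+st) (cong (_, m ∷ S ++ st) (++-identityʳ _))
  ; increasing = Allₚ.++⁻ˡ S m<S+st ∷ increasing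
  ; pushed↭    = ↭-trans (↭-prep m pushed↭) (↭ₚ.∷↭∷ʳ m (noRightChild ta))
  }
  where open PartialRun ra renaming (pushed to S)
PartialRun-pivot {f} {st} {ta} {a} {m} b@(y ∷ ys) ra |b|≤ m<S+st (m<y ∷ _) b<S+st runsOn = record
  { pushed     = S′ ++ S
  ; runs       = begin
      runStack st (a ++ m ∷ y ∷ ys)
        ≡⟨ runStack-pivot runs m<S+st ⟩
      (D ++ proj₁ (runStack (m ∷ S ++ st) b) , proj₂ (runStack (m ∷ S ++ st) b))
        ≡⟨ cong (λ r → D ++ proj₁ r , proj₂ r) (runStack-pop-top (S ++ st) ys m<y) ⟩
      (D ++ m ∷ proj₁ (runStack (S ++ st) b) , proj₂ (runStack (S ++ st) b))
        ≡⟨ cong (λ r → D ++ m ∷ proj₁ r , proj₂ r) (PartialRun.runs rb) ⟩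
      (D ++ m ∷ inorderWithRightChild tb , S′ ++ S ++ st)
        ≡⟨ cong₂ _,_ (sym (inorderWithRightChild-node ta m tb (lamF-≢leaf |b|≤))) (sym (++-assoc S′ S st)) ⟩
      (inorderWithRightChild (node ta m tb) , (S′ ++ S) ++ st) ∎
  ; increasing = AllPairsₚ.++⁺ (PartialRun.increasing rb) increasing S′<S
  ; pushed↭    = subst (S′ ++ S ↭_) (sym (noRightChild-node ta m tb (lamF-≢leaf |b|≤)))
                   (↭-trans (↭ₚ.++-comm S′ S) (↭ₚ.++⁺ pushed↭ (PartialRun.pushed↭ rb)))
  }
  where
  open ≡-Reasoning
  open PartialRun ra renaming (pushed to S)
  D  = inorderWithRightChild ta
  tb = lamF f b
  rb = runsOn b<S+st
  S′ = PartialRun.pushed rb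
  S′<S : S′ ≺ S
  S′<S = ↭ₚ.All-resp-↭ (↭-sym (PartialRun.pushed↭ rb))
           (Sublistₚ.All-resp-⊆ (noRightChild-lamF-⊆ f b |b|≤)
             (All.map (Allₚ.++⁻ˡ S) b<S+st))

runStack-Avoids213 : ∀ f σ {st} → length σ ≤ f → Avoids213 σ → Unique σ → σ ≺ st → PartialRun st (lamF f σ) σ
runStack-Avoids213 f σ le avoids u σ<st with lamSplit f σ le
... | [] rewrite lamF-[] f = record { pushed = [] ; runs = refl ; increasing = [] ; pushed↭ = ↭-refl }
... | split {f} a m b |a|≤ |b|≤ m≤ lamF≡ rewrite lamF≡ =
  PartialRun-pivot b ra |b|≤ (Allₚ.++⁺ m<S (All.lookup σ<st (∈-insert a))) m<b (≺-++⁺ʳ b<S b<st)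
    (runStack-Avoids213 f b |b|≤ (Avoids213-⊆ (Sublistₚ.++⁺ˡ a (m ∷ʳ ⊆-refl)) avoids) ub)
  where
  m<a = proj₁ (pivot-min a u m≤)
  m<b = proj₂ (pivot-min a u m≤)
  ub = proj₁ (proj₂ (Unique-++⁻ [ m ] (proj₁ (proj₂ (Unique-++⁻ a u)))))
  b<st = All.tail (Allₚ.++⁻ʳ a σ<st)
  ra = runStack-Avoids213 f a |a|≤ (Avoids213-⊆ (Sublistₚ.++⁺ʳ (m ∷ b) ⊆-refl) avoids)
         (proj₁ (Unique-++⁻ a u)) (Allₚ.++⁻ˡ a σ<st)
  S↭ : PartialRun.pushed ra ↭ noRightChild (lamF f a)
  S↭ = PartialRun.pushed↭ ra
  m<S = ↭ₚ.All-resp-↭ (↭-sym S↭) (Sublistₚ.All-resp-⊆ (noRightChild-lamF-⊆ f a |a|≤) m<a)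
  b<S = ≺-resp-↭ʳ (↭-sym S↭) (≺-resp-⊆ʳ (noRightChild-lamF-⊆ f a |a|≤) (Avoids213-pivot a avoids u m<a))

record Pending (st E w : List ℕ) : Set where
  field
    increasing : Increasing st
    pending↭   : E ↭ st
    fresh      : All (_∉ w) st

-- Both sides are the increasing arrangement of the letters of s and τ.
stackSortFrom≡PhiWith-Increasing : ∀ f τ {s E} → length τ ≤ f → Increasing τ → Pending s E τ →
  stackSortFrom s τ ≡ inorder (PhiWith E (lamF f τ))
stackSortFrom≡PhiWith-Increasing f τ {s} {E} le incτ pending = begin
  stackSortFrom s τ       ≡⟨ Increasing-↭⇒≡ (stackSortFrom-increasing s τ increasing incτ fresh) incE perm ⟩
  inorder (insertAll E t) ≡⟨ cong inorder (PhiWith-RightArm E arm) ⟨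
  inorder (PhiWith E t)   ∎
  where
  open ≡-Reasoning
  open Pending pending
  t = lamF f τ
  arm = lamF-RightArm f τ le incτ
  t≡τ = inorder-lamF f τ le
  incE : Increasing (inorder (insertAll E t))
  incE = proj₂ (insertAll-RightArm E arm (subst Increasing (sym t≡τ) incτ)
           (Unique-resp-↭ (↭-sym pending↭) (Increasing⇒Unique increasing))
           (↭ₚ.All-resp-↭ (↭-sym pending↭) (subst (λ w → All (_∉ w) s) (sym t≡τ) fresh)))
  perm : stackSortFrom s τ ↭ inorder (insertAll E t)
  perm = ↭-trans (stackSortFrom-↭ s τ)
        (↭-trans (↭ₚ.++⁺ʳ τ (↭-sym pending↭))
        (↭-trans (↭-reflexive (cong (E ++_) (sym t≡τ))) (↭-sym (insertAll-↭ E t))))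

-- One step of the simultaneous recursion on w = σ m τ, m the smallest letter.
record Peeled (f : ℕ) (st E σ : List ℕ) (m : ℕ) (τ : List ℕ) : Set where
  field
    pushed  : List ℕ
    pushed↭ : pushed ↭ noRightChild (lamF f σ)
    m<stack : All (m <_) (pushed ++ st)
    pending : Pending (pushed ++ st) (E ++ noRightChild (lamF f σ)) τ
    sorts   : stackSortFrom st (σ ++ m ∷ τ) ≡
              inorderWithRightChild (lamF f σ) ++ m ∷ stackSortFrom (pushed ++ st) τ
    Phis    : inorder (PhiWith E (node (lamF f σ) m (lamF f τ))) ≡
              inorderWithRightChild (lamF f σ) ++ m ∷ inorder (PhiWith (E ++ noRightChild (lamF f σ)) (lamF f τ))

peel : ∀ f σ m τ {st E} → length σ ≤ f → length τ ≤ f → Avoids213 σ → Unique (σ ++ m ∷ τ) →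
       All (m <_) σ → All (m <_) τ → σ ≺ st → All (m <_) st → Pending st E (σ ++ m ∷ τ) → Peeled f st E σ m τ
peel f σ m τ {st} {E} |σ|≤ |τ|≤ avoids u m<σ m<τ σ<st m<st pend = record
  { pushed  = S
  ; pushed↭ = S↭
  ; m<stack = m<S+st
  ; pending = record
      { increasing = AllPairsₚ.++⁺ (PartialRun.increasing ra) (Pending.increasing pend)
                       (↭ₚ.All-resp-↭ (↭-sym S↭) (Sublistₚ.All-resp-⊆ Nσ⊆σ σ<st))
      ; pending↭   = ↭-trans (↭ₚ.++⁺ (Pending.pending↭ pend) (↭-sym S↭)) (↭ₚ.++-comm st S)
      ; fresh      = Allₚ.++⁺ (↭ₚ.All-resp-↭ (↭-sym S↭) (Sublistₚ.All-resp-⊆ Nσ⊆σ σ∉τ))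
                       (All.map (λ y∉ y∈τ → y∉ (∈-++⁺ʳ σ (there y∈τ))) (Pending.fresh pend))
      }
  ; sorts   = stackSortFrom-pivot (PartialRun.runs ra) m<S+st m<τ
  ; Phis    = PhiWith-node E tσ m tτ (↭ₚ.All-resp-↭ (↭-sym (Pending.pending↭ pend)) m<st)
                (subst (All (m <_)) (sym tσ≡σ) m<σ) (subst (All (m <_)) (sym tτ≡τ) m<τ)
                (subst₂ (λ a b → Unique (a ++ b)) (sym tσ≡σ) (sym tτ≡τ)
                  (AllPairs-resp-⊆ (Sublistₚ.++⁺ ⊆-refl (m ∷ʳ ⊆-refl)) u))
                (subst (All (_∉ E)) (sym tσ≡σ) σ∉E)
  }
  where
  tσ = lamF f σ
  tτ = lamF f τ
  tσ≡σ = inorder-lamF f σ |σ|≤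
  tτ≡τ = inorder-lamF f τ |τ|≤
  Nσ⊆σ = noRightChild-lamF-⊆ f σ |σ|≤
  parts = Unique-++⁻ σ u
  ra = runStack-Avoids213 f σ |σ|≤ avoids (proj₁ parts) σ<st
  S = PartialRun.pushed ra
  S↭ = PartialRun.pushed↭ ra
  m<S+st = Allₚ.++⁺ (↭ₚ.All-resp-↭ (↭-sym S↭) (Sublistₚ.All-resp-⊆ Nσ⊆σ m<σ)) m<st
  σ∉τ : All (_∉ τ) σ
  σ∉τ = All.map (λ y∉ y∈ → y∉ (there y∈)) (proj₂ (proj₂ parts))
  σ∉E : All (_∉ E) σ
  σ∉E = All.tabulate λ y∈σ y∈E →
    All.lookup (Pending.fresh pend) (↭ₚ.∈-resp-↭ (Pending.pending↭ pend) y∈E) (∈-++⁺ˡ y∈σ)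

SortsAsPhi : List ℕ → List ℕ → Tree → List ℕ → List ℕ → Set
SortsAsPhi st E t w R = stackSortFrom st w ≡ inorder (PhiWith E t) × reduceTail (stackSortFrom st w) ⊆ R

module _ {f st E σ m τ} (p : Peeled f st E σ m τ) where
  open Peeled p

  private
    s  = pushed ++ st
    E′ = E ++ noRightChild (lamF f σ)

  peel-combine : ∀ {R′} → length σ ≤ f → stackSortFrom s τ ≡ inorder (PhiWith E′ (lamF f τ)) →
    reduceTail (m ∷ stackSortFrom s τ) ⊆ m ∷ R′ →
    SortsAsPhi st E (node (lamF f σ) m (lamF f τ)) (σ ++ m ∷ τ) (σ ++ m ∷ R′)
  peel-combine |σ|≤ sortsτ reducedτ =
    trans sorts (trans (cong (λ o → D ++ m ∷ o) sortsτ) (sym Phis)) ,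
    subst (λ o → reduceTail o ⊆ σ ++ m ∷ _) (sym sorts)
      (⊆-trans (reduceTail-++ D (m ∷ stackSortFrom s τ)) (Sublistₚ.++⁺ D⊆σ reducedτ))
    where
    D = inorderWithRightChild (lamF f σ)
    D⊆σ = subst (D ⊆_) (inorder-lamF f σ |σ|≤) (inorderWithRightChild-⊆ (lamF f σ))

  peel-recurse : ∀ {R′} → length σ ≤ f → SortsAsPhi s E′ (lamF f τ) τ R′ →
    SortsAsPhi st E (node (lamF f σ) m (lamF f τ)) (σ ++ m ∷ τ) (σ ++ m ∷ R′)
  peel-recurse |σ|≤ (sortsτ , reducedτ) =
    peel-combine |σ|≤ sortsτ (⊆-trans (reduceTail-∷ m (stackSortFrom s τ)) (refl ∷ reducedτ))

  peel-below : ∀ {R′} → length σ ≤ f → R′ ≺ σ → R′ ≺ st → R′ ≺ s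
  peel-below |σ|≤ R′<σ R′<st =
    ≺-++⁺ʳ (≺-resp-↭ʳ (↭-sym pushed↭) (≺-resp-⊆ʳ (noRightChild-lamF-⊆ f σ |σ|≤) R′<σ)) R′<st

  peel-finish : ∀ {R′} → length σ ≤ f → length τ ≤ f → Increasing τ → All (m <_) τ →
    SortsAsPhi st E (node (lamF f σ) m (lamF f τ)) (σ ++ m ∷ τ) (σ ++ m ∷ R′)
  peel-finish |σ|≤ |τ|≤ incτ m<τ = peel-combine |σ|≤ (stackSortFrom≡PhiWith-Increasing f τ |τ|≤ incτ pending)
    (subst (_⊆ m ∷ _) (sym (reduceTail-Increasing (m<rest ∷ inc-rest))) (refl ∷ minimum _))
    where
    inc-rest = stackSortFrom-increasing s τ (Pending.increasing pending) incτ (Pending.fresh pending)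
    m<rest = ↭ₚ.All-resp-↭ (↭-sym (stackSortFrom-↭ s τ)) (Allₚ.++⁺ m<stack m<τ)

peel-reduced : ∀ f σ m τ R′ {st E} → length σ ≤ f → length τ ≤ f → Unique (σ ++ m ∷ τ) →
  All (m <_) σ → All (m <_) τ → Avoids213 (σ ++ m ∷ R′) → σ ++ m ∷ R′ ≺ st → Pending st E (σ ++ m ∷ τ) →
  Peeled f st E σ m τ
peel-reduced f σ m τ R′ |σ|≤ |τ|≤ u m<σ m<τ avoids R<st =
  peel f σ m τ |σ|≤ |τ|≤ (Avoids213-⊆ (Sublistₚ.++⁺ʳ (m ∷ R′) ⊆-refl) avoids) u m<σ m<τ
    (Allₚ.++⁻ˡ σ R<st) (All.lookup R<st (∈-insert σ))

-- F ++ take 1 T is the reduced word of w = F T when T is its tail.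
stackSortFrom≡PhiWith : ∀ f w F T {st E} → length w ≤ f → w ≢ [] → w ≡ F ++ T → Increasing T → Unique w →
  Avoids213 (F ++ take 1 T) → F ++ take 1 T ≺ st → Pending st E w → SortsAsPhi st E (lamF f w) w (F ++ take 1 T)
stackSortFrom≡PhiWith f w F T {st} {E} le w≢[] w≡ incT u avoids R<st pend with lamSplit f w le
... | [] = ⊥-elim (w≢[] refl)
... | split {f} σ m τ |σ|≤ |τ|≤ m≤ lamF≡ rewrite lamF≡ with pivot-in-++ σ m τ F T w≡ | pivot-min σ u m≤
...   | inj₂ (inj₁ (refl , refl)) | m<σ , m<τ =
  peel-finish (peel-reduced f σ m τ [] |σ|≤ |τ|≤ u m<σ m<τ avoids R<st pend)
    |σ|≤ |τ|≤ (AllPairs.tail incT) m<τ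
...   | inj₁ ([] , refl , refl) | m<σ , m<τ =
  subst (SortsAsPhi st E (node (lamF f σ) m (lamF f T)) (σ ++ m ∷ T)) (sym R≡)
    (peel-finish (peel-reduced f σ m T (take 1 T) |σ|≤ |τ|≤ u m<σ m<τ (subst Avoids213 R≡ avoids)
                    (subst (_≺ _) R≡ R<st) pend) |σ|≤ |τ|≤ incT m<τ)
  where
  R≡ : (σ ++ [ m ]) ++ take 1 T ≡ σ ++ m ∷ take 1 T
  R≡ = ++-assoc σ [ m ] (take 1 T)
...   | inj₁ (z ∷ c , refl , refl) | m<σ , m<τ =
  subst (SortsAsPhi st E (node (lamF f σ) m (lamF f (z ∷ c ++ T))) (σ ++ m ∷ z ∷ c ++ T)) (sym R≡)
    (peel-recurse p |σ|≤
      (stackSortFrom≡PhiWith f (z ∷ c ++ T) (z ∷ c) T |τ|≤ (λ ()) refl incT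
         (AllPairs.tail (proj₁ (proj₂ (Unique-++⁻ σ u))))
         (Avoids213-⊆ (Sublistₚ.++⁺ˡ σ (m ∷ʳ ⊆-refl)) avoidsR)
         (peel-below p |σ|≤ (Avoids213-pivot σ avoidsR uR m<σ) (All.tail (Allₚ.++⁻ʳ σ R<st′)))
         (Peeled.pending p)))
  where
  R′ = z ∷ c ++ take 1 T
  R≡ : (σ ++ m ∷ z ∷ c) ++ take 1 T ≡ σ ++ m ∷ R′
  R≡ = ++-assoc σ (m ∷ z ∷ c) (take 1 T)
  avoidsR = subst Avoids213 R≡ avoids
  R<st′ = subst (_≺ _) R≡ R<st
  uR : Unique (σ ++ m ∷ R′)
  uR = AllPairs-resp-⊆ (Sublistₚ.++⁺ ⊆-refl (refl ∷ Sublistₚ.++⁺ ⊆-refl (Sublistₚ.take-⊆ 1 T))) u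
  p = peel-reduced f σ m (z ∷ c ++ T) R′ |σ|≤ |τ|≤ u m<σ m<τ avoidsR R<st′ pend
-- m is below every letter of σ, so it cannot follow one in the increasing tail.
...   | inj₂ (inj₂ (z , d , refl , refl)) | m<σ , _ with incT
...     | z< ∷ _ = ⊥-elim (<-asym (All.lookup z< (∈-insert d)) (All.lookup m<σ (∈-insert F)))

lemma3p5 : (n : ℕ) (π : List ℕ) → π ↭ map suc (upTo n) → Tailed213 π →
    (stackSort π ≡ inorder (Phi (lam π))) × Tailed213 (stackSort π)
lemma3p5 n []         _  tailed = refl , tailed
lemma3p5 n π@(_ ∷ _) π↭ tailed =
  trans sorts (proj₁ agree) ,
  Avoids213-⊆ (subst (λ o → reduceTail o ⊆ reduceTail π) (sym sorts) (proj₂ agree)) tailed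
  where
  u : Unique π
  u = Unique-resp-↭ (↭-sym π↭) (Uniqueₚ.map⁺ suc-injective (Uniqueₚ.upTo⁺ n))
  sorts : stackSort π ≡ stackSortFrom [] π
  sorts = stackSortF≡stackSortFrom (length π) π ≤-refl u
  agree : SortsAsPhi [] [] (lam π) π (reduceTail π)
  agree = stackSortFrom≡PhiWith (length π) π (proj₁ (splitTail π)) (proj₂ (splitTail π)) ≤-refl (λ ())
            (sym (proj₁ (splitTail-correct π))) (proj₂ (splitTail-correct π)) u tailed
            (All.tabulate (λ _ → [])) (record { increasing = [] ; pending↭ = ↭-refl ; fresh = [] })
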